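{- Let $G=(V,E)$ be a regular graph of even degree $d\geq 3$, with parity block decomposition $G=\cup_{j\in J} P_j$. Let $C_d$ be the cycle graph of length $d$, with vertex set $[d]$. Then there is a one-to-one correspondence between the set of parity blocks $\{P_j\}_{j\in J}$ and the set of connected components $\{S_j\}_{j\in J}$ of the zig-zag product $G\circ_z C_d$.
   Context: $G$ is a finite connected bi-labelled $d$-regular graph: at each vertex the incident edges get distinct colors from $[d]=\{1,\dots,d\}$, encoded by a rotation map $\operatorname{Rot}_G(v,h)=(w,k)$ if an edge joins $v,w$ colored $h$ near $v$ and $k$ near $w$. $C_d$ has vertex set $[d]$, vertex $k$ adjacent to $k\pm1$ (indices mod $d$, taken in $[d]$). The zig-zag product $G\circ_z C_d$ has vertex set $V\times[d]$ and rotation map $\operatorname{Rot}((v,k),(i,j))=((w,l),(j',i'))$ whenever $\operatorname{Rot}_{C_d}(k,i)=(k',i')$, $\operatorname{Rot}_{G}(v,k')=(w,l')$, $\operatorname{Rot}_{C_d}(l',j)=(l,j')$. Let $[d_e]$ (resp. $[d_o]$) be the even (resp. odd) elements of $[d]$. For $v\in V$ and $i\in\{e,o\}$, the parity block $P(v,i)$ is the subgraph of $G$ whose vertices are all $w$ reachable from $v$ by a path $v=v_0,v_1,\dots,v_n=w$ with $\operatorname{Rot}_G(v_k,i_k)=(v_{k+1},j_k)$, $i_0\in[d_i]$ and $i_{k+1}\equiv j_k \pmod 2$, and whose edges are the edges (with their bi-labelling) used by such paths. If $w\in P(v,i)$ has parity $i_w$ (parity of the last label $j_{n-1}$ of such a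 path), then $P(v,i)=P(w,i_w)$; hence $G$ decomposes uniquely into parity blocks, written $G=\cup_j P_j$ (the parity block decomposition). -}

module Defs where

open import Data.Nat using (ℕ; zero; suc; _+_)
open import Data.Nat.DivMod using (_mod_)
open import Data.Fin using (Fin; toℕ)
open import Data.Product using (Σ; ∃; _×_; _,_; proj₁; proj₂)
open import Data.Sum using (_⊎_)
open import Relation.Binary.PropositionalEquality using (_≡_)
open import Relation.Binary.Construct.Closure.ReflexiveTransitive using (Star)
open import Function.Bundles using (_⇔_)

-- Conventions.
-- A finite bi-labelled d-regular graph on n vertices: vertices Fin n,
-- colours [d] = {1,…,d} represented by Fin d, where h : Fin d stands
-- for the colour suc (toℕ h).

RotMap : ℕ → ℕ → Set
RotMap n d = Fin n → Fin d → Fin n × Fin d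

-- A rotation map encodes an (undirected, bi-labelled) graph iff it is an
-- involution: Rot (Rot (v , h)) = (v , h).
IsRotationMap : ∀ {n d} → RotMap n d → Set
IsRotationMap {n} {d} Rot =
  ∀ (v : Fin n) (h : Fin d) →
    Rot (proj₁ (Rot v h)) (proj₂ (Rot v h)) ≡ (v , h)

Adj : ∀ {n d} → RotMap n d → Fin n → Fin n → Set
Adj {n} {d} Rot v w = Σ (Fin d) λ h → proj₁ (Rot v h) ≡ w

Connected : ∀ {n d} → RotMap n d → Set
Connected {n} Rot = ∀ (v w : Fin n) → Star (Adj Rot) v w

data Parity : Set where
  e o : Parity

flip : Parity → Parity
flip e = o
flip o = e

parityℕ : ℕ → Parity
parityℕ zero = e
parityℕ (suc m) = flip (parityℕ m)

IsEven : ℕ → Set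
IsEven m = parityℕ m ≡ e

par : ∀ {d} → Fin d → Parity
par h = parityℕ (suc (toℕ h))

sucMod : ∀ {d} → Fin d → Fin d
sucMod {suc m} k = suc (toℕ k) mod suc m

predMod : ∀ {d} → Fin d → Fin d
predMod {suc m} k = (toℕ k + m) mod suc m

RotC : ∀ {d} → Fin d → Fin 2 → Fin d × Fin 2
RotC k Fin.zero = sucMod k , Fin.suc Fin.zero
RotC k (Fin.suc _) = predMod k , Fin.zero

ZZRot : ∀ {n d} → RotMap n d →
        Fin n × Fin d → Fin 2 × Fin 2 → (Fin n × Fin d) × (Fin 2 × Fin 2)
ZZRot Rot (v , k) (i , j) =
  let k' = proj₁ (RotC k i)
      i' = proj₂ (RotC k i)
      w  = proj₁ (Rot v k')
      l' = proj₂ (Rot v k')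
      l  = proj₁ (RotC l' j)
      j' = proj₂ (RotC l' j)
  in (w , l) , (j' , i')

ZZAdj : ∀ {n d} → RotMap n d → Fin n × Fin d → Fin n × Fin d → Set
ZZAdj Rot x y = Σ (Fin 2 × Fin 2) λ ij → proj₁ (ZZRot Rot x ij) ≡ y

ZZConn : ∀ {n d} → RotMap n d → Fin n × Fin d → Fin n × Fin d → Set
ZZConn Rot = Star (ZZAdj Rot)

-- PPath Rot v i w q : there is a path
-- v = v₀, …, v_m = w (m ≥ 1) with Rot(v_k , i_k) = (v_{k+1} , j_k),
-- i₀ of parity i, i_{k+1} ≡ j_k (mod 2), and last label j_{m-1} of parity q.

data PPath {n d} (Rot : RotMap n d) : Fin n → Parity → Fin n → Parity → Set where
  one  : ∀ (v : Fin n) (h : Fin d) →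
         PPath Rot v (par h) (proj₁ (Rot v h)) (par (proj₂ (Rot v h)))
  step : ∀ {v i u q} (h : Fin d) → PPath Rot v i u q → par h ≡ q →
         PPath Rot v i (proj₁ (Rot u h)) (par (proj₂ (Rot u h)))

-- Vertices of the parity block P(v,i) (paths of length 0 included).
VertexIn : ∀ {n d} → RotMap n d → Fin n → Parity → Fin n → Set
VertexIn Rot v i w = w ≡ v ⊎ ∃ λ q → PPath Rot v i w q

-- Some admissible path from (v,i) leaves x along the colour h
-- (either as first step, or after a path arriving at x with matching parity).
Traverses : ∀ {n d} → RotMap n d → Fin n → Parity → Fin n → Fin d → Set
Traverses Rot v i x h = (x ≡ v × par h ≡ i) ⊎ PPath Rot v i x (par h)

-- The edge of G through the half-edge (x , h) (i.e. {(x,h),Rot(x,h)})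
-- is an edge of P(v,i): it is used by such a path in either direction.
EdgeIn : ∀ {n d} → RotMap n d → Fin n → Parity → Fin n → Fin d → Set
EdgeIn Rot v i x h =
  Traverses Rot v i x h ⊎ Traverses Rot v i (proj₁ (Rot x h)) (proj₂ (Rot x h))

SameBlock : ∀ {n d} → RotMap n d → Fin n × Parity → Fin n × Parity → Set
SameBlock {n} {d} Rot (v , i) (w , j) =
  (∀ (x : Fin n) → VertexIn Rot v i x ⇔ VertexIn Rot w j x) ×
  (∀ (x : Fin n) (h : Fin d) → EdgeIn Rot v i x h ⇔ EdgeIn Rot w j x h)

module Submission where

-- Both sides are described by one auxiliary graph on "states"
-- (v , p) ∈ V × Parity: a state steps along any colour h of parity p,
-- arriving at (Rot v h) with the parity of the arrival colour.
--   * Parity blocks: P(v,i) = P(w,j) iff (v,i) and (w,j) are joined in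
--     the state graph (for d ≥ 2; uses that Rot is an involution).
--   * Zig-zag: inside a fibre {v} × [d] two vertices whose colours have
--     the same parity are connected (double cycle steps k ↦ k+2 climb from
--     the bottom colour of that parity), and every zig-zag edge projects,
--     via (v , a) ↦ (v , parity of the 0-based index of a), to a state
--     step; conversely each state step lifts to a zig-zag walk.  This is
--     where d even is used: the cycle steps always flip colour parity.
-- So s ↦ (v , entry p) (the lowest colour in the fibre realising the
-- state) maps the blocks bijectively onto the components.

open import Defs
open import Data.Nat using (ℕ; _≤_)
open import Data.Fin using (Fin)
open import Data.Product using (Σ; ∃; _×_; _,_)
open import Function.Bundles using (_⇔_)

open import Data.Nat using (zero; suc; _+_; _<_; _%_; s≤s)
open import Data.Nat.Properties using (<-trans; n<1+n; +-comm; +-assoc; +-suc; m≤n⇒m<n∨m≡n)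
open import Data.Nat.DivMod using (%-distribˡ-+; m%n%n≡m%n; [m+n]%n≡m%n; m<n⇒m%n≡m; n%n≡0)
open import Data.Fin using (toℕ; fromℕ<) renaming (zero to fzero; suc to fsuc)
open import Data.Fin.Properties using (toℕ-injective; toℕ<n; toℕ-fromℕ<; fromℕ<-toℕ)
open import Data.Product using (proj₁; proj₂)
open import Data.Sum using (_⊎_; inj₁; inj₂)
open import Relation.Binary.PropositionalEquality
open import Relation.Binary.Construct.Closure.ReflexiveTransitive
open import Function.Bundles using (mk⇔; Equivalence)

flip-involutive : ∀ p → flip (flip p) ≡ p
flip-involutive e = refl
flip-involutive o = refl

flip-injective : ∀ {p q} → flip p ≡ flip q → p ≡ q
flip-injective {p} {q} eq =
  trans (sym (flip-involutive p)) (trans (cong flip eq) (flip-involutive q))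

module CycleArithmetic (m : ℕ) where

  D : ℕ
  D = suc m

  toℕ-sucMod : (a : Fin D) → toℕ (sucMod a) ≡ suc (toℕ a) % D
  toℕ-sucMod a = toℕ-fromℕ< _

  toℕ-predMod : (a : Fin D) → toℕ (predMod a) ≡ (toℕ a + m) % D
  toℕ-predMod a = toℕ-fromℕ< _

  %-absorbˡ : ∀ x y → (x % D + y) % D ≡ (x + y) % D
  %-absorbˡ x y = begin
      (x % D + y) % D              ≡⟨ %-distribˡ-+ (x % D) y D ⟩
      (x % D % D + y % D) % D      ≡⟨ cong (λ z → (z + y % D) % D) (m%n%n≡m%n x D) ⟩
      (x % D + y % D) % D          ≡⟨ sym (%-distribˡ-+ x y D) ⟩
      (x + y) % D                  ∎
    where open ≡-Reasoning

  add-D : (a : Fin D) → (toℕ a + D) % D ≡ toℕ a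
  add-D a = trans ([m+n]%n≡m%n (toℕ a) D) (m<n⇒m%n≡m (toℕ<n a))

  sucMod-predMod : (a : Fin D) → sucMod (predMod a) ≡ a
  sucMod-predMod a = toℕ-injective (begin
      toℕ (sucMod (predMod a))      ≡⟨ toℕ-sucMod (predMod a) ⟩
      suc (toℕ (predMod a)) % D     ≡⟨ cong (λ z → suc z % D) (toℕ-predMod a) ⟩
      (1 + (toℕ a + m) % D) % D     ≡⟨ cong (_% D) (+-comm 1 ((toℕ a + m) % D)) ⟩
      ((toℕ a + m) % D + 1) % D     ≡⟨ %-absorbˡ (toℕ a + m) 1 ⟩
      (toℕ a + m + 1) % D           ≡⟨ cong (_% D) (trans (+-assoc (toℕ a) m 1) (cong (toℕ a +_) (+-comm m 1))) ⟩
      (toℕ a + D) % D               ≡⟨ add-D a ⟩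
      toℕ a                         ∎)
    where open ≡-Reasoning

  predMod-sucMod : (a : Fin D) → predMod (sucMod a) ≡ a
  predMod-sucMod a = toℕ-injective (begin
      toℕ (predMod (sucMod a))      ≡⟨ toℕ-predMod (sucMod a) ⟩
      (toℕ (sucMod a) + m) % D      ≡⟨ cong (λ z → (z + m) % D) (toℕ-sucMod a) ⟩
      (suc (toℕ a) % D + m) % D     ≡⟨ %-absorbˡ (suc (toℕ a)) m ⟩
      (suc (toℕ a) + m) % D         ≡⟨ cong (_% D) (sym (+-suc (toℕ a) m)) ⟩
      (toℕ a + D) % D               ≡⟨ add-D a ⟩
      toℕ a                         ∎)
    where open ≡-Reasoning

  RotC-involutive : ∀ (a : Fin D) (i : Fin 2) →
    RotC (proj₁ (RotC a i)) (proj₂ (RotC a i)) ≡ (a , i)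
  RotC-involutive a fzero = cong (_, fzero) (predMod-sucMod a)
  RotC-involutive a (fsuc fzero) = cong (_, fsuc fzero) (sucMod-predMod a)

  sucMod-fromℕ< : ∀ {x} (x<D : x < D) (1+x<D : suc x < D) →
    sucMod (fromℕ< x<D) ≡ fromℕ< 1+x<D
  sucMod-fromℕ< {x} x<D 1+x<D = toℕ-injective (begin
      toℕ (sucMod (fromℕ< x<D))    ≡⟨ toℕ-sucMod (fromℕ< x<D) ⟩
      suc (toℕ (fromℕ< x<D)) % D   ≡⟨ cong (λ z → suc z % D) (toℕ-fromℕ< x<D) ⟩
      suc x % D                     ≡⟨ m<n⇒m%n≡m 1+x<D ⟩
      suc x                         ≡⟨ sym (toℕ-fromℕ< 1+x<D) ⟩
      toℕ (fromℕ< 1+x<D)           ∎)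
    where open ≡-Reasoning

module CycleParity (k : ℕ) (d-even : IsEven (suc (suc k))) where
  open CycleArithmetic (suc k)

  par-sucMod : (a : Fin D) → par (sucMod a) ≡ flip (par a)
  par-sucMod a with m≤n⇒m<n∨m≡n (toℕ<n a)
  ... | inj₁ 1+a<D =
    cong (λ z → parityℕ (suc z)) (trans (toℕ-sucMod a) (m<n⇒m%n≡m 1+a<D))
  ... | inj₂ 1+a≡D = begin
      parityℕ (suc (toℕ (sucMod a)))   ≡⟨ cong (λ z → parityℕ (suc z)) wraps ⟩
      o                                 ≡⟨ cong flip (sym d-even) ⟩
      flip (parityℕ D)                  ≡⟨ cong (λ z → flip (parityℕ z)) (sym 1+a≡D) ⟩
      flip (par a)                      ∎
    where
    open ≡-Reasoning
    wraps : toℕ (sucMod a) ≡ 0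
    wraps = trans (toℕ-sucMod a) (trans (cong (_% D) 1+a≡D) (n%n≡0 D))

  par-predMod : (a : Fin D) → par (predMod a) ≡ flip (par a)
  par-predMod a = begin
      par (predMod a)                         ≡⟨ sym (flip-involutive _) ⟩
      flip (flip (par (predMod a)))           ≡⟨ cong flip (sym (par-sucMod (predMod a))) ⟩
      flip (par (sucMod (predMod a)))         ≡⟨ cong (λ z → flip (par z)) (sucMod-predMod a) ⟩
      flip (par a)                            ∎
    where open ≡-Reasoning

  par-RotC : ∀ (a : Fin D) (i : Fin 2) → par (proj₁ (RotC a i)) ≡ flip (par a)
  par-RotC a fzero = par-sucMod a
  par-RotC a (fsuc fzero) = par-predMod a

module ZigZagSymmetry {n} (m : ℕ) (Rot : RotMap n (suc m)) (inv : IsRotationMap Rot) where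
  open CycleArithmetic m

  ZZRot-involutive : ∀ x ij →
    ZZRot Rot (proj₁ (ZZRot Rot x ij)) (proj₂ (ZZRot Rot x ij)) ≡ (x , ij)
  ZZRot-involutive (v , a) (i , j)
    rewrite RotC-involutive (proj₂ (Rot v (proj₁ (RotC a i)))) j
          | inv v (proj₁ (RotC a i))
          | RotC-involutive a i = refl

  ZZAdj-sym : ∀ {x y} → ZZAdj Rot x y → ZZAdj Rot y x
  ZZAdj-sym {x} (ij , refl) = proj₂ (ZZRot Rot x ij) , cong proj₁ (ZZRot-involutive x ij)

  ZZConn-sym : ∀ {x y} → ZZConn Rot x y → ZZConn Rot y x
  ZZConn-sym = reverse ZZAdj-sym

module ZigZagFibres {n} (k : ℕ) (Rot : RotMap n (suc (suc k))) (inv : IsRotationMap Rot) where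
  open CycleArithmetic (suc k)
  open ZigZagSymmetry (suc k) Rot inv

  -- The lowest colour whose 0-based index has parity p.
  entry : Parity → Fin D
  entry e = fzero
  entry o = fsuc fzero

  -- Labels (0,0) then (1,0): go out along colour a+1 and straight back,
  -- moving two steps up the cycle.
  double-step : ∀ v (a : Fin D) → ZZConn Rot (v , a) (v , sucMod (sucMod a))
  double-step v a = ((fzero , fzero) , refl) ◅ ((fsuc fzero , fzero) , back) ◅ ε
    where
    w  = proj₁ (Rot v (sucMod a))
    l' = proj₂ (Rot v (sucMod a))
    back : proj₁ (ZZRot Rot (w , sucMod l') (fsuc fzero , fzero)) ≡ (v , sucMod (sucMod a))
    back = cong (λ p → proj₁ p , sucMod (proj₂ p))
                (trans (cong (Rot w) (predMod-sucMod l')) (inv v (sucMod a)))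

  climb : ∀ v x (x<D : x < D) → ZZConn Rot (v , entry (parityℕ x)) (v , fromℕ< x<D)
  climb v zero _ = ε
  climb v (suc zero) _ = ε
  climb v (suc (suc x)) 2+x<D =
    subst (λ p → ZZConn Rot (v , entry p) (v , fromℕ< 2+x<D))
          (sym (flip-involutive (parityℕ x)))
          (climb v x x<D ◅◅ subst (λ b → ZZConn Rot (v , fromℕ< x<D) (v , b)) two-up
                                  (double-step v (fromℕ< x<D)))
    where
    1+x<D : suc x < D
    1+x<D = <-trans (n<1+n (suc x)) 2+x<D
    x<D : x < D
    x<D = <-trans (n<1+n x) 1+x<D
    two-up : sucMod (sucMod (fromℕ< x<D)) ≡ fromℕ< 2+x<D
    two-up = trans (cong sucMod (sucMod-fromℕ< x<D 1+x<D)) (sucMod-fromℕ< 1+x<D 2+x<D)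

  from-entry : ∀ v (b : Fin D) → ZZConn Rot (v , entry (parityℕ (toℕ b))) (v , b)
  from-entry v b = subst (λ c → ZZConn Rot (v , entry (parityℕ (toℕ b))) (v , c))
                         (fromℕ<-toℕ b (toℕ<n b)) (climb v (toℕ b) (toℕ<n b))

  -- Pass through the common entry colour (going down by symmetry).
  same-parity-connected : ∀ v (a b : Fin D) → par a ≡ par b → ZZConn Rot (v , a) (v , b)
  same-parity-connected v a b pa≡pb =
    ZZConn-sym (from-entry v a) ◅◅
    subst (λ p → ZZConn Rot (v , entry p) (v , b)) (sym (flip-injective pa≡pb)) (from-entry v b)

module StateGraph {n d} (Rot : RotMap n d) (inv : IsRotationMap Rot) where

  State : Set
  State = Fin n × Parity

  Step : State → State → Set
  Step (v , p) (w , q) =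
    Σ (Fin d) λ h → par h ≡ p × proj₁ (Rot v h) ≡ w × par (proj₂ (Rot v h)) ≡ q

  Reach : State → State → Set
  Reach = Star Step

  -- A step is traversed backwards along the reverse half-edge.
  step-sym : ∀ {s t} → Step s t → Step t s
  step-sym {v , _} (h , ph , refl , refl) =
    proj₂ (Rot v h) , refl , cong proj₁ (inv v h) ,
    trans (cong (λ z → par (proj₂ z)) (inv v h)) ph

  reach-sym : ∀ {s t} → Reach s t → Reach t s
  reach-sym = reverse step-sym

  -- A parity path is precisely a non-empty state walk.
  path⇒reach : ∀ {v i w q} → PPath Rot v i w q → Reach (v , i) (w , q)
  path⇒reach (one v h) = (h , refl , refl , refl) ◅ ε
  path⇒reach (step h p ph) = path⇒reach p ◅◅ ((h , ph , refl , refl) ◅ ε)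

  Reached : Fin n → Parity → State → Set
  Reached v i s = s ≡ (v , i) ⊎ PPath Rot v i (proj₁ s) (proj₂ s)

  extend : ∀ {v i s t} → Reached v i s → Step s t → PPath Rot v i (proj₁ t) (proj₂ t)
  extend (inj₁ refl) (h , refl , refl , refl) = one _ h
  extend (inj₂ p) (h , ph , refl , refl) = step h p ph

  reach⇒reached : ∀ {v i s t} → Reached v i s → Reach s t → Reached v i t
  reach⇒reached r ε = r
  reach⇒reached r (st ◅ sts) = reach⇒reached (inj₂ (extend r st)) sts

  traverses⇒reach : ∀ {v i x h} → Traverses Rot v i x h → Reach (v , i) (x , par h)
  traverses⇒reach (inj₁ (refl , refl)) = ε
  traverses⇒reach (inj₂ p) = path⇒reach p

  reach⇒traverses : ∀ {v i x h} → Reach (v , i) (x , par h) → Traverses Rot v i x h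
  reach⇒traverses r with reach⇒reached (inj₁ refl) r
  ... | inj₁ refl = inj₁ (refl , refl)
  ... | inj₂ p = inj₂ p

  vertexIn⇒reach : ∀ {v i x} → VertexIn Rot v i x → ∃ λ q → Reach (v , i) (x , q)
  vertexIn⇒reach {i = i} (inj₁ refl) = i , ε
  vertexIn⇒reach (inj₂ (q , p)) = q , path⇒reach p

  reach⇒vertexIn : ∀ {v i x q} → Reach (v , i) (x , q) → VertexIn Rot v i x
  reach⇒vertexIn {q = q} r with reach⇒reached (inj₁ refl) r
  ... | inj₁ refl = inj₁ refl
  ... | inj₂ p = inj₂ (q , p)

  vertexIn-transport : ∀ {a b x} → Reach a b →
    VertexIn Rot (proj₁ b) (proj₂ b) x → VertexIn Rot (proj₁ a) (proj₂ a) x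
  vertexIn-transport r vx with vertexIn⇒reach vx
  ... | _ , r' = reach⇒vertexIn (r ◅◅ r')

  edgeIn-transport : ∀ {a b x h} → Reach a b →
    EdgeIn Rot (proj₁ b) (proj₂ b) x h → EdgeIn Rot (proj₁ a) (proj₂ a) x h
  edgeIn-transport {h = h} r (inj₁ t) =
    inj₁ (reach⇒traverses {h = h} (r ◅◅ traverses⇒reach {h = h} t))
  edgeIn-transport {x = x} {h} r (inj₂ t) =
    inj₂ (reach⇒traverses {h = h'} (r ◅◅ traverses⇒reach {h = h'} t))
    where h' = proj₂ (Rot x h)

  reach⇒sameBlock : ∀ a b → Reach a b → SameBlock Rot a b
  reach⇒sameBlock a b r =
    (λ x → mk⇔ (vertexIn-transport (reach-sym r)) (vertexIn-transport r)) ,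
    (λ x h → mk⇔ (edgeIn-transport (reach-sym r)) (edgeIn-transport r))

  -- Conversely, if both parities occur among the colours: the first edge
  -- of P(v,i) is an edge of P(w,j), so it is reached from (w,j) in one
  -- of its two directions.
  sameBlock⇒reach : (∀ i → Σ (Fin d) λ h → par h ≡ i) →
    ∀ a b → SameBlock Rot a b → Reach a b
  sameBlock⇒reach colour (v , i) (w , j) (_ , sameEdges) with colour i
  ... | h , refl with Equivalence.to (sameEdges v h) (inj₁ (inj₁ (refl , refl)))
  ... | inj₁ t = reach-sym (traverses⇒reach {h = h} t)
  ... | inj₂ t = reach-sym (traverses⇒reach {h = proj₂ (Rot v h)} t ◅◅ (step-sym (h , refl , refl , refl) ◅ ε))

-- A zig-zag vertex (v , a) projects
-- to the state (v , parity of the 0-based index of a), i.e. the parity of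
-- the G-colours one cycle step away; a state (v , p) lifts to (v , entry p).

module Correspondence {n} (k : ℕ) (Rot : RotMap n (suc (suc k))) (inv : IsRotationMap Rot)
                      (d-even : IsEven (suc (suc k))) where
  open CycleArithmetic (suc k)
  open CycleParity k d-even
  open ZigZagFibres k Rot inv
  open StateGraph Rot inv

  project : Fin n × Fin D → State
  project (v , a) = v , parityℕ (toℕ a)

  lift : State → Fin n × Fin D
  lift (v , p) = v , entry p

  project-lift : ∀ s → project (lift s) ≡ s
  project-lift (v , e) = refl
  project-lift (v , o) = refl

  par-entry : ∀ p → par (entry p) ≡ flip p
  par-entry e = refl
  par-entry o = refl

  colour-of-parity : ∀ i → Σ (Fin D) λ h → par h ≡ i
  colour-of-parity o = fzero , refl
  colour-of-parity e = fsuc fzero , refl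

  -- A zig-zag edge is: cycle step, G-edge, cycle step; both cycle steps
  -- flip colour parity, so it projects to a state step along the G-edge.
  zzAdj⇒step : ∀ {x y} → ZZAdj Rot x y → Step (project x) (project y)
  zzAdj⇒step {v , a} ((i , j) , refl) =
    proj₁ (RotC a i) , trans (par-RotC a i) (flip-involutive _) , refl ,
    sym (flip-injective (par-RotC (proj₂ (Rot v (proj₁ (RotC a i)))) j))

  -- A state step along colour h lifts to: move in the fibre to h-1, take
  -- the zig-zag edge with labels (0,0) across h, move in the target fibre.
  step⇒zzConn : ∀ {s t} → Step s t → ZZConn Rot (lift s) (lift t)
  step⇒zzConn {v , _} (h , refl , refl , refl) =
    same-parity-connected v (entry (par h)) (predMod h)
      (trans (par-entry (par h)) (sym (par-predMod h))) ◅◅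
    ((fzero , fzero) , across) ◅
    same-parity-connected w (sucMod l') (entry (par l'))
      (trans (par-sucMod l') (sym (par-entry (par l'))))
    where
    w  = proj₁ (Rot v h)
    l' = proj₂ (Rot v h)
    across : proj₁ (ZZRot Rot (v , predMod h) (fzero , fzero)) ≡ (w , sucMod l')
    across = cong (λ c → proj₁ (Rot v c) , sucMod (proj₂ (Rot v c))) (sucMod-predMod h)

  reach⇒zzConn : ∀ {a b} → Reach a b → ZZConn Rot (lift a) (lift b)
  reach⇒zzConn ε = ε
  reach⇒zzConn (st ◅ sts) = step⇒zzConn st ◅◅ reach⇒zzConn sts

  zzConn⇒reach : ∀ {a b} → ZZConn Rot (lift a) (lift b) → Reach a b
  zzConn⇒reach {a} {b} z =
    subst₂ Reach (project-lift a) (project-lift b) (gmap project zzAdj⇒step z)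

  sameBlock⇔zzConn : ∀ a b → SameBlock Rot a b ⇔ ZZConn Rot (lift a) (lift b)
  sameBlock⇔zzConn a b =
    mk⇔ (λ sb → reach⇒zzConn (sameBlock⇒reach colour-of-parity a b sb))
        (λ z → reach⇒sameBlock a b (zzConn⇒reach z))

  lift-project-connected : ∀ y → ZZConn Rot (lift (project y)) y
  lift-project-connected (v , a) = from-entry v a

-- Theorem 4.3: s ↦ lift s induces a bijection between parity blocks and
-- components of G ∘z C_d.

theorem4p3 : ∀ (n d : ℕ) (Rot : RotMap n d) →
    IsRotationMap Rot → Connected Rot → IsEven d → 3 ≤ d →
    Σ (Fin n × Parity → Fin n × Fin d) λ f →
      (∀ a b → SameBlock Rot a b ⇔ ZZConn Rot (f a) (f b)) ×
      (∀ y → ∃ λ a → ZZConn Rot (f a) y)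
theorem4p3 n (suc (suc k)) Rot inv _ d-even _ =
  lift , sameBlock⇔zzConn , λ y → project y , lift-project-connected y
  where open Correspondence k Rot inv d-even
theorem4p3 n zero Rot _ _ _ ()
theorem4p3 n (suc zero) Rot _ _ _ (s≤s ())
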